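{- Let $G$ be a connected graph with maximum degree $\Delta$. For every $X\subseteq V(G)$ with $|X|\ge\Delta+2$ there exist a vertex $v(X)\in V(G)$ and a natural number $r(X)$ such that $$\frac{1}{\Delta+2}|X|\le |B(v(X),r(X))\cap X|\le\frac{\Delta+1}{\Delta+2}|X|.$$
   Context: $B(v,r)$ denotes the set of vertices of $G$ at graph distance at most $r$ from $v$. -}

module Defs where

open import Data.Nat using (ℕ; zero; suc; _≤_)
open import Data.Fin using (Fin)
open import Data.Fin.Subset using (Subset; ∣_∣; _∈_)
open import Data.Bool using (Bool; true; false)
open import Data.Vec using (tabulate)
open import Data.Product using (Σ; ∃; _×_)
open import Relation.Binary.PropositionalEquality using (_≡_)
open import Relation.Nullary using (¬_)

record Graph (n : ℕ) : Set where
  field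
    adj     : Fin n → Fin n → Bool
    sym     : ∀ u v → adj u v ≡ adj v u
    irrefl  : ∀ v → adj v v ≡ false

open Graph public

Adj : ∀ {n} → Graph n → Fin n → Fin n → Set
Adj G u v = adj G u v ≡ true

data Walk {n} (G : Graph n) : Fin n → Fin n → ℕ → Set where
  here : ∀ {v} → Walk G v v zero
  step : ∀ {u w v k} → Adj G u w → Walk G w v k → Walk G u v (suc k)

DistLE : ∀ {n} → Graph n → Fin n → Fin n → ℕ → Set
DistLE G u w r = ∃ λ k → k ≤ r × Walk G u w k

InBall : ∀ {n} → Graph n → Fin n → ℕ → Fin n → Set
InBall G v r w = DistLE G v w r

Connected : ∀ {n} → Graph n → Set
Connected G = ∀ u v → ∃ λ k → Walk G u v k

N : ∀ {n} → Graph n → Fin n → Subset n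
N G v = tabulate (adj G v)

deg : ∀ {n} → Graph n → Fin n → ℕ
deg G v = ∣ N G v ∣

MaxDegree : ∀ {n} → Graph n → ℕ → Set
MaxDegree G Δ = (∀ v → deg G v ≤ Δ) × ∃ λ v → deg G v ≡ Δ

IsBallCap : ∀ {n} → Graph n → Fin n → ℕ → Subset n → Subset n → Set
IsBallCap G v r X S = ∀ w → (w ∈ S → InBall G v r w × w ∈ X) × (InBall G v r w × w ∈ X → w ∈ S)

module Submission where

-- Write x = |X| and call a ball B(v,r) heavy if
-- (Δ+1)·x < (Δ+2)·|B(v,r) ∩ X|, light if (Δ+2)·|B(v,r) ∩ X| < x, and
-- balanced if it is neither, which is exactly the required conclusion.
-- By connectivity some ball B(v₀,R) contains all of X, so it is heavy.
-- A heavy ball has radius at least 1 (a single vertex is never heavy, as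
-- x ≥ Δ+2).  Given a heavy ball B(v,r+1): if some ball of radius r is
-- heavy we recurse on it; otherwise, if some neighbour u of v has a
-- non-light ball B(u,r), that ball is balanced; and not every neighbour
-- can have a light ball, since B(v,r+1) ∩ X ⊆ {v} ∪ ⋃_{u~v} (B(u,r) ∩ X) would
-- then give (Δ+2)·|B(v,r+1) ∩ X| ≤ (Δ+2) + Δ·(x-1) ≤ (Δ+1)·x.

open import Defs
open import Data.Nat using (ℕ; _+_; _*_; _≤_)
open import Data.Fin using (Fin)
open import Data.Fin.Subset using (Subset; ∣_∣)
open import Data.Product using (Σ; ∃; _×_)

open import Data.Nat using (zero; suc; _<_; _⊔_; pred; z≤n; s≤s; _<?_; _≤?_; NonZero; >-nonZero)
open import Data.Nat.Properties
  using ( ≤-trans; ≤-reflexive; n≤1+n; +-suc; +-mono-≤; +-monoʳ-≤; *-monoʳ-≤; *-monoˡ-≤; *-distribˡ-+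
        ; *-zeroʳ; *-identityʳ; m≤m⊔n; m≤n⊔m; m≤n+m; m≤n*m; ≤-pred; pred-mono-≤; suc-pred
        ; ≮⇒≥; ≰⇒>; <-≤-trans; <-irrefl; +-monoʳ-<; *-monoˡ-<; n<1+n; module ≤-Reasoning )
open import Data.Nat.Tactic.RingSolver using (solve-∀)
open import Data.Fin using (zero; suc)
open import Data.Fin.Properties using (any?)
open import Data.Fin.Subset using (_∈_; _⊆_; _∪_; _∩_; ⊥; ⁅_⁆; inside; outside)
open import Data.Fin.Subset.Properties
  using ( x∈⁅x⁆; x∈⁅y⁆⇒x≡y; ∣⁅x⁆∣≡1; ∣⊥∣≡0; ∉⊥; p⊆p∪q; q⊆p∪q; x∈p∪q⁻
        ; x∈p∩q⁺; x∈p∩q⁻; p⊆q⇒∣p∣≤∣q∣; ∣p∩q∣≤∣p∣ )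
open import Data.Bool using (Bool; true; false; if_then_else_; _≟_)
open import Data.Vec using ([]; _∷_; tabulate)
open import Data.Product using (_,_; proj₁; proj₂; map)
open import Function using (id)
open import Data.Sum using (inj₁; inj₂)
open import Data.Empty using (⊥-elim)
open import Relation.Nullary using (¬_; yes; no; _×-dec_)
open import Relation.Binary.PropositionalEquality using (_≡_; refl; trans; cong)
  renaming (sym to ≡-sym)

private
  variable
    n k : ℕ

∣p∪q∣≤∣p∣+∣q∣ : (p q : Subset n) → ∣ p ∪ q ∣ ≤ ∣ p ∣ + ∣ q ∣
∣p∪q∣≤∣p∣+∣q∣ []            []            = z≤n
∣p∪q∣≤∣p∣+∣q∣ (inside  ∷ p) (inside  ∷ q) =
  s≤s (≤-trans (∣p∪q∣≤∣p∣+∣q∣ p q) (+-monoʳ-≤ ∣ p ∣ (n≤1+n ∣ q ∣)))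
∣p∪q∣≤∣p∣+∣q∣ (inside  ∷ p) (outside ∷ q) = s≤s (∣p∪q∣≤∣p∣+∣q∣ p q)
∣p∪q∣≤∣p∣+∣q∣ (outside ∷ p) (inside  ∷ q) =
  ≤-trans (s≤s (∣p∪q∣≤∣p∣+∣q∣ p q)) (≤-reflexive (≡-sym (+-suc ∣ p ∣ ∣ q ∣)))
∣p∪q∣≤∣p∣+∣q∣ (outside ∷ p) (outside ∷ q) = ∣p∪q∣≤∣p∣+∣q∣ p q

c*∣p∪q∣≤c*∣p∣+c*∣q∣ : (c : ℕ) (p q : Subset n) → c * ∣ p ∪ q ∣ ≤ c * ∣ p ∣ + c * ∣ q ∣
c*∣p∪q∣≤c*∣p∣+c*∣q∣ c p q =
  ≤-trans (*-monoʳ-≤ c (∣p∪q∣≤∣p∣+∣q∣ p q)) (≤-reflexive (*-distribˡ-+ c ∣ p ∣ ∣ q ∣))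

⋃⟨_⟩ : (Fin k → Bool) → (Fin k → Subset n) → Subset n
⋃⟨_⟩ {zero}  a P = ⊥
⋃⟨_⟩ {suc k} a P = if a zero then P zero ∪ rest else rest
  where
  rest = ⋃⟨ (λ u → a (suc u)) ⟩ (λ u → P (suc u))

∈⋃⁺ : (a : Fin k → Bool) (P : Fin k → Subset n) {u : Fin k} {w : Fin n} →
      a u ≡ true → w ∈ P u → w ∈ ⋃⟨ a ⟩ P
∈⋃⁺ a P {zero}  au w∈ rewrite au = p⊆p∪q _ w∈
∈⋃⁺ a P {suc u} au w∈ with a zero
... | true  = q⊆p∪q (P zero) _ (∈⋃⁺ (λ i → a (suc i)) (λ i → P (suc i)) au w∈)
... | false = ∈⋃⁺ (λ i → a (suc i)) (λ i → P (suc i)) au w∈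

∈⋃⁻ : (a : Fin k → Bool) (P : Fin k → Subset n) {w : Fin n} →
      w ∈ ⋃⟨ a ⟩ P → ∃ λ u → a u ≡ true × w ∈ P u
∈⋃⁻ {zero}  a P w∈ = ⊥-elim (∉⊥ w∈)
∈⋃⁻ {suc k} a P w∈ with a zero in a₀
... | false = map suc id (∈⋃⁻ (λ i → a (suc i)) (λ i → P (suc i)) w∈)
... | true with x∈p∪q⁻ (P zero) _ w∈
...   | inj₁ w∈P₀   = zero , a₀ , w∈P₀
...   | inj₂ w∈rest = map suc id (∈⋃⁻ (λ i → a (suc i)) (λ i → P (suc i)) w∈rest)

⋃-bound : ∀ {k n} (c m : ℕ) (a : Fin k → Bool) (P : Fin k → Subset n) →
          (∀ u → a u ≡ true → c * ∣ P u ∣ ≤ m) → c * ∣ ⋃⟨ a ⟩ P ∣ ≤ ∣ tabulate a ∣ * m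
⋃-bound {zero} {n} c m a P small = ≤-reflexive (trans (cong (c *_) (∣⊥∣≡0 n)) (*-zeroʳ c))
⋃-bound {suc k} c m a P small with a zero in a₀
... | true  = ≤-trans (c*∣p∪q∣≤c*∣p∣+c*∣q∣ c (P zero) _)
                      (+-mono-≤ (small zero a₀) (⋃-bound c m _ _ (λ u → small (suc u))))
... | false = ⋃-bound c m _ _ (λ u → small (suc u))

finite-bound : (f : Fin k → ℕ) → ∃ λ M → ∀ i → f i ≤ M
finite-bound {zero}  f = 0 , λ ()
finite-bound {suc k} f with finite-bound (λ i → f (suc i))
... | M , bound = f zero ⊔ M , λ { zero → m≤m⊔n _ _ ; (suc i) → ≤-trans (bound i) (m≤n⊔m _ _) }

module Balls {n} (G : Graph n) where

  Ball : Fin n → ℕ → Subset n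
  Ball v zero    = ⁅ v ⁆
  Ball v (suc r) = ⁅ v ⁆ ∪ ⋃⟨ adj G v ⟩ (λ u → Ball u r)

  centre∈Ball : ∀ v r → v ∈ Ball v r
  centre∈Ball v zero    = x∈⁅x⁆ v
  centre∈Ball v (suc r) = p⊆p∪q _ (x∈⁅x⁆ v)

  Ball-sound : ∀ v r {w} → w ∈ Ball v r → InBall G v r w
  Ball-sound v zero w∈ with x∈⁅y⁆⇒x≡y v w∈
  ... | refl = 0 , z≤n , here
  Ball-sound v (suc r) w∈ with x∈p∪q⁻ ⁅ v ⁆ _ w∈
  ... | inj₁ w∈⁅v⁆ with x∈⁅y⁆⇒x≡y v w∈⁅v⁆
  ...   | refl = 0 , z≤n , here
  Ball-sound v (suc r) w∈ | inj₂ w∈U with ∈⋃⁻ (adj G v) _ w∈U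
  ... | u , v~u , w∈Bu with Ball-sound u r w∈Bu
  ...   | k , k≤r , walk = suc k , s≤s k≤r , step v~u walk

  walk⇒∈Ball : ∀ {v w k} r → Walk G v w k → k ≤ r → w ∈ Ball v r
  walk⇒∈Ball r       here             _         = centre∈Ball _ r
  walk⇒∈Ball (suc r) (step v~u walk) (s≤s k≤r) =
    q⊆p∪q ⁅ _ ⁆ _ (∈⋃⁺ (adj G _) _ v~u (walk⇒∈Ball r walk k≤r))

  Ball-complete : ∀ v r {w} → InBall G v r w → w ∈ Ball v r
  Ball-complete v r (k , k≤r , walk) = walk⇒∈Ball r walk k≤r

  Ball∩-isBallCap : ∀ v r X → IsBallCap G v r X (Ball v r ∩ X)
  Ball∩-isBallCap v r X w = sound , complete
    where
    sound : w ∈ Ball v r ∩ X → InBall G v r w × w ∈ X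
    sound w∈ with x∈p∩q⁻ (Ball v r) X w∈
    ... | w∈B , w∈X = Ball-sound v r w∈B , w∈X
    complete : InBall G v r w × w ∈ X → w ∈ Ball v r ∩ X
    complete (inBall , w∈X) = x∈p∩q⁺ (Ball-complete v r inBall , w∈X)

  Ball-covers : Connected G → ∀ v → ∃ λ R → ∀ w → w ∈ Ball v R
  Ball-covers conn v with finite-bound (λ w → proj₁ (conn v w))
  ... | R , bound = R , λ w → walk⇒∈Ball R (proj₂ (conn v w)) (bound w)

  ∣Ball₀∩X∣≤1 : ∀ v X → ∣ Ball v 0 ∩ X ∣ ≤ 1
  ∣Ball₀∩X∣≤1 v X = ≤-trans (∣p∩q∣≤∣p∣ ⁅ v ⁆ X) (≤-reflexive (∣⁅x⁆∣≡1 v))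

  Ball-step-⊆ : ∀ v r X → Ball v (suc r) ∩ X ⊆ ⁅ v ⁆ ∪ ⋃⟨ adj G v ⟩ (λ u → Ball u r ∩ X)
  Ball-step-⊆ v r X w∈ with x∈p∩q⁻ (Ball v (suc r)) X w∈
  ... | w∈B , w∈X with x∈p∪q⁻ ⁅ v ⁆ _ w∈B
  ...   | inj₁ w∈⁅v⁆ = p⊆p∪q _ w∈⁅v⁆
  ...   | inj₂ w∈U with ∈⋃⁻ (adj G v) _ w∈U
  ...     | u , v~u , w∈Bu = q⊆p∪q ⁅ v ⁆ _ (∈⋃⁺ (adj G v) _ v~u (x∈p∩q⁺ (w∈Bu , w∈X)))

  Ball-step-bound : ∀ c m v r X → (∀ u → Adj G v u → c * ∣ Ball u r ∩ X ∣ ≤ m) →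
                    c * ∣ Ball v (suc r) ∩ X ∣ ≤ c + deg G v * m
  Ball-step-bound c m v r X small = begin
    c * ∣ Ball v (suc r) ∩ X ∣   ≤⟨ *-monoʳ-≤ c (p⊆q⇒∣p∣≤∣q∣ (Ball-step-⊆ v r X)) ⟩
    c * ∣ ⁅ v ⁆ ∪ U ∣            ≤⟨ c*∣p∪q∣≤c*∣p∣+c*∣q∣ c ⁅ v ⁆ U ⟩
    c * ∣ ⁅ v ⁆ ∣ + c * ∣ U ∣    ≤⟨ +-mono-≤ (≤-reflexive c*∣⁅v⁆∣≡c) (⋃-bound c m (adj G v) _ small) ⟩
    c + deg G v * m              ∎
    where
    open ≤-Reasoning
    U = ⋃⟨ adj G v ⟩ (λ u → Ball u r ∩ X)
    c*∣⁅v⁆∣≡c : c * ∣ ⁅ v ⁆ ∣ ≡ c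
    c*∣⁅v⁆∣≡c = trans (cong (c *_) (∣⁅x⁆∣≡1 v)) (*-identityʳ c)

step-arith : ∀ Δ d m → d ≤ Δ → 1 ≤ m → (Δ + 2) + d * m ≤ (Δ + 1) * suc m
step-arith Δ d m d≤Δ 1≤m = begin
  (Δ + 2) + d * m        ≤⟨ +-monoʳ-≤ (Δ + 2) (*-monoˡ-≤ m d≤Δ) ⟩
  (Δ + 2) + Δ * m        ≡⟨ lhs-form Δ m ⟩
  (Δ + 1 + Δ * m) + 1    ≤⟨ +-monoʳ-≤ (Δ + 1 + Δ * m) 1≤m ⟩
  (Δ + 1 + Δ * m) + m    ≡⟨ rhs-form Δ m ⟩
  (Δ + 1) * suc m        ∎
  where
  open ≤-Reasoning
  lhs-form : ∀ Δ m → (Δ + 2) + Δ * m ≡ (Δ + 1 + Δ * m) + 1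
  lhs-form = solve-∀
  rhs-form : ∀ Δ m → (Δ + 1 + Δ * m) + m ≡ (Δ + 1) * suc m
  rhs-form = solve-∀

module Descent {n} (G : Graph n) (Δ : ℕ) (X : Subset n)
               (deg≤Δ : ∀ v → deg G v ≤ Δ) (Δ+2≤∣X∣ : Δ + 2 ≤ ∣ X ∣) where
  open Balls G

  weight : Fin n → ℕ → ℕ
  weight v r = (Δ + 2) * ∣ Ball v r ∩ X ∣

  Heavy Light Balanced : Fin n → ℕ → Set
  Heavy    v r = (Δ + 1) * ∣ X ∣ < weight v r
  Light    v r = weight v r < ∣ X ∣
  Balanced v r = ∣ X ∣ ≤ weight v r × weight v r ≤ (Δ + 1) * ∣ X ∣

  m : ℕ
  m = pred ∣ X ∣

  2≤∣X∣ : 2 ≤ ∣ X ∣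
  2≤∣X∣ = ≤-trans (m≤n+m 2 Δ) Δ+2≤∣X∣

  instance
    ∣X∣-nonZero : NonZero ∣ X ∣
    ∣X∣-nonZero = >-nonZero (≤-trans (s≤s z≤n) 2≤∣X∣)

  ∣X∣≡1+m : ∣ X ∣ ≡ suc m
  ∣X∣≡1+m = ≡-sym (suc-pred ∣ X ∣)

  radius-0-not-heavy : ∀ v → ¬ Heavy v 0
  radius-0-not-heavy v heavy = <-irrefl refl (<-≤-trans heavy (begin
    (Δ + 2) * ∣ Ball v 0 ∩ X ∣ ≤⟨ *-monoʳ-≤ (Δ + 2) (∣Ball₀∩X∣≤1 v X) ⟩
    (Δ + 2) * 1               ≡⟨ *-identityʳ (Δ + 2) ⟩
    Δ + 2                     ≤⟨ Δ+2≤∣X∣ ⟩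
    ∣ X ∣                     ≤⟨ m≤n*m ∣ X ∣ (Δ + 1) {{>-nonZero (m≤n+m 1 Δ)}} ⟩
    (Δ + 1) * ∣ X ∣           ∎))
    where open ≤-Reasoning

  light-neighbours⇒not-heavy : ∀ v r → (∀ u → Adj G v u → Light u r) → ¬ Heavy v (suc r)
  light-neighbours⇒not-heavy v r light heavy = <-irrefl refl (<-≤-trans heavy (begin
    weight v (suc r)           ≤⟨ Ball-step-bound (Δ + 2) m v r X light-bound ⟩
    (Δ + 2) + deg G v * m      ≤⟨ step-arith Δ (deg G v) m (deg≤Δ v) 1≤m ⟩
    (Δ + 1) * suc m            ≡⟨ cong ((Δ + 1) *_) (≡-sym ∣X∣≡1+m) ⟩
    (Δ + 1) * ∣ X ∣            ∎))
    where
    open ≤-Reasoning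
    1≤m : 1 ≤ m
    1≤m = pred-mono-≤ 2≤∣X∣
    light-bound : ∀ u → Adj G v u → weight u r ≤ m
    light-bound u v~u = ≤-pred (≤-trans (light u v~u) (≤-reflexive ∣X∣≡1+m))

  descend : ∀ r v → Heavy v r → Σ (Fin n) λ u → Σ ℕ λ r′ → Balanced u r′
  descend zero    v heavy = ⊥-elim (radius-0-not-heavy v heavy)
  descend (suc r) v heavy with any? (λ v′ → (Δ + 1) * ∣ X ∣ <? weight v′ r)
  ... | yes (v′ , heavy′) = descend r v′ heavy′
  ... | no no-heavy with any? (λ u → (adj G v u ≟ true) ×-dec (∣ X ∣ ≤? weight u r))
  ...   | yes (u , _ , not-light) = u , r , not-light , ≮⇒≥ (λ heavy′ → no-heavy (u , heavy′))
  ...   | no no-heavy-neighbour   = ⊥-elim (light-neighbours⇒not-heavy v r all-light heavy)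
    where
    all-light : ∀ u → Adj G v u → Light u r
    all-light u v~u = ≰⇒> (λ not-light → no-heavy-neighbour (u , v~u , not-light))

  covering-ball-heavy : ∀ v R → (∀ w → w ∈ Ball v R) → Heavy v R
  covering-ball-heavy v R covers = <-≤-trans (*-monoˡ-< ∣ X ∣ Δ+1<Δ+2)
                                             (*-monoʳ-≤ (Δ + 2) ∣X∣≤∣Ball∩X∣)
    where
    Δ+1<Δ+2 : Δ + 1 < Δ + 2
    Δ+1<Δ+2 = +-monoʳ-< Δ (n<1+n 1)
    ∣X∣≤∣Ball∩X∣ : ∣ X ∣ ≤ ∣ Ball v R ∩ X ∣
    ∣X∣≤∣Ball∩X∣ = p⊆q⇒∣p∣≤∣q∣ (λ {w} w∈X → x∈p∩q⁺ (covers w , w∈X))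

lemma4p1 : ∀ {n} (G : Graph n) (Δ : ℕ) → Connected G → MaxDegree G Δ →
    (X : Subset n) → Δ + 2 ≤ ∣ X ∣ →
    Σ (Fin n) λ v → Σ ℕ λ r → Σ (Subset n) λ S →
    IsBallCap G v r X S × ∣ X ∣ ≤ (Δ + 2) * ∣ S ∣ × (Δ + 2) * ∣ S ∣ ≤ (Δ + 1) * ∣ X ∣
lemma4p1 G Δ connected (deg≤Δ , v₀ , _) X Δ+2≤∣X∣ =
  let R , covers         = Ball-covers connected v₀
      v , r , balanced   = descend R v₀ (covering-ball-heavy v₀ R covers)
  in  v , r , Ball v r ∩ X , Ball∩-isBallCap v r X , balanced
  where
  open Balls G
  open Descent G Δ X deg≤Δ Δ+2≤∣X∣
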